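{- Let $p$ be a prime and $Q \in \mathbb{Z}[x]$ a polynomial with no roots in $\{0,1,2,\ldots\}$, such that $Q$ has at least one root in $\mathbb{Z}/p\mathbb{Z}$ and every $b \in \mathbb{Z}$ with $Q(b)\equiv 0 \pmod p$ satisfies $Q'(b) \not\equiv 0 \pmod p$. For $n \in \mathbb{N}$ let $$r_n = \max\{ j : p^j \text{ divides } Q(i) \text{ for some } 1 \le i \le n\}.$$ Then $r_n \to \infty$ as $n \to \infty$. Moreover, for all sufficiently large $n$, $p^{r_n} \le n^{\deg(Q)+1}$; hence $r_n = O(\log n)$.
   Context: $Q'$ denotes the formal derivative of $Q$. -}

module Defs where

open import Data.Nat as ℕ using (ℕ; zero; suc; _≤_; _^_)
open import Data.Integer as ℤ using (ℤ; +_; 0ℤ)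
open import Data.Integer.Divisibility using (_∣_)
open import Data.List using (List; []; _∷_)
open import Data.Bool using (Bool; true; false; if_then_else_; _∧_)
open import Data.Product using (Σ; _×_; ∃-syntax)
open import Relation.Nullary.Decidable using (⌊_⌋)

-- A polynomial in ℤ[x] is represented by its list of coefficients,
-- lowest degree first: a₀ ∷ a₁ ∷ … represents a₀ + a₁ x + …
-- (trailing zero coefficients are allowed and do not matter).
Poly : Set
Poly = List ℤ

eval : Poly → ℤ → ℤ
eval []       x = 0ℤ
eval (a ∷ as) x = a ℤ.+ x ℤ.* eval as x

derivAux : ℕ → Poly → Poly
derivAux k []       = []
derivAux k (a ∷ as) = (+ k) ℤ.* a ∷ derivAux (suc k) as

deriv : Poly → Poly
deriv []       = []
deriv (a ∷ as) = derivAux 1 as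

isZeroPoly : Poly → Bool
isZeroPoly []       = true
isZeroPoly (a ∷ as) = ⌊ a ℤ.≟ 0ℤ ⌋ ∧ isZeroPoly as

-- degree (index of the highest nonzero coefficient; 0 for constants
-- and, by convention, for the zero polynomial)
deg : Poly → ℕ
deg []       = 0
deg (a ∷ as) = if isZeroPoly as then 0 else suc (deg as)

IsRn : ℕ → Poly → ℕ → ℕ → Set
IsRn p Q n r =
  (Σ ℕ λ i → (1 ≤ i) × (i ≤ n) × ((+ (p ^ r)) ∣ eval Q (+ i)))
  × (∀ i j → 1 ≤ i → i ≤ n → (+ (p ^ j)) ∣ eval Q (+ i) → j ℕ.≤ r)

module Submission where

open import Defs
open import Data.Nat using (ℕ; _≤_; _^_; _+_)
open import Data.Nat.Primality using (Prime)
open import Data.Integer using (ℤ; +_; 0ℤ)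
open import Data.Integer.Divisibility using (_∣_)
open import Data.Product using (Σ; _×_)
open import Relation.Binary.PropositionalEquality using (_≢_)
open import Relation.Nullary using (¬_)

open import Data.Nat as ℕ using (zero; suc; _<_; s≤s; z≤n)
import Data.Nat.Properties as ℕP
open import Algebra.Properties.CommutativeSemigroup ℕP.*-commutativeSemigroup
  using () renaming (x∙yz≈y∙xz to *-left-comm)
open import Data.Nat.Primality using (prime⇒irreducible; prime⇒nonZero; prime⇒nonTrivial)
open import Data.Nat.Coprimality using (Coprime; coprime-Bézout)
open import Data.Nat.GCD using (module Bézout)
import Data.Nat.Divisibility as ℕD
open import Data.Integer as ℤ using (1ℤ; -[1+_])
import Data.Integer.Properties as ℤP
open import Data.Integer.Divisibility.Signed as S using (divides; ∣ᵤ⇒∣; ∣⇒∣ᵤ)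
  renaming (_∣_ to _∣ₛ_)
open import Data.Integer.DivMod using (a≡a%n+[a/n]*n)
open import Data.Integer.Tactic.RingSolver using (solve-∀)
open import Data.List using ([]; _∷_)
open import Data.Bool using (true; false)
open import Data.Product using (_,_; proj₁; proj₂)
open import Data.Sum using (inj₁; inj₂)
open import Data.Empty using (⊥-elim)
open import Relation.Nullary using (Dec; yes; no)
open import Relation.Nullary.Decidable using (map′; _×-dec_)
open import Relation.Binary.PropositionalEquality using (_≡_; refl; sym; trans; cong; cong₂; subst; module ≡-Reasoning)

-- Proof of Lemma 2.2.  Write Q′ for the formal derivative and ‖Q‖₁ for the
-- sum of the absolute values of the coefficients of Q.
--
-- (1) Size.  |Q(i)| ≤ ‖Q‖₁ · i^deg Q for i ≥ 1.  Since Q does not vanish on ℕ,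
--     p^j ∣ Q(i) forces p^j ≤ |Q(i)|, so every exponent j occurring in the
--     definition of r_n satisfies j < p^j ≤ ‖Q‖₁ · n^deg Q.  This bounds the
--     (decidable, non-empty) set of such exponents, so its maximum r_n exists;
--     and for n ≥ ‖Q‖₁ it gives p^(r_n) ≤ n · n^deg Q = n^(deg Q + 1).
-- (2) Growth.  The Taylor expansion Q(x + h) = Q(x) + h Q′(x) + h² R yields
--     Hensel's lemma: a root b of Q modulo p^(k+1) at which Q′(b) is a unit
--     modulo p lifts to a root modulo p^(k+2).  Iterating from the given root
--     modulo p gives roots modulo every p^(M+1); by the same expansion roots
--     modulo m are m-periodic, so there is one at a positive integer i, and
--     then r_n ≥ M + 1 for all n ≥ i.

-- Raising every weight of derivAux by one adds the polynomial itself: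
-- Σ (k+1+j) aⱼ xʲ = Σ (k+j) aⱼ xʲ + Σ aⱼ xʲ.
derivAux-suc : ∀ k as x →
  eval (derivAux (suc k) as) x ≡ eval (derivAux k as) x ℤ.+ eval as x
derivAux-suc k []       x = refl
derivAux-suc k (a ∷ as) x = begin
  + suc k ℤ.* a ℤ.+ x ℤ.* eval (derivAux (suc (suc k)) as) x
    ≡⟨ cong (λ t → + suc k ℤ.* a ℤ.+ x ℤ.* t) (derivAux-suc (suc k) as x) ⟩
  + suc k ℤ.* a ℤ.+ x ℤ.* (eval (derivAux (suc k) as) x ℤ.+ eval as x)
    ≡⟨ regroup (+ k) a x (eval (derivAux (suc k) as) x) (eval as x) ⟩
  (+ k ℤ.* a ℤ.+ x ℤ.* eval (derivAux (suc k) as) x) ℤ.+ (a ℤ.+ x ℤ.* eval as x) ∎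
  where
  open ≡-Reasoning
  regroup : ∀ k a x D E →
    (1ℤ ℤ.+ k) ℤ.* a ℤ.+ x ℤ.* (D ℤ.+ E) ≡ (k ℤ.* a ℤ.+ x ℤ.* D) ℤ.+ (a ℤ.+ x ℤ.* E)
  regroup = solve-∀

deriv-cons : ∀ a as x →
  eval (deriv (a ∷ as)) x ≡ eval as x ℤ.+ x ℤ.* eval (deriv as) x
deriv-cons a []       x = zero-sum x
  where
  zero-sum : ∀ x → 0ℤ ≡ 0ℤ ℤ.+ x ℤ.* 0ℤ
  zero-sum = solve-∀
deriv-cons a (c ∷ cs) x = begin
  1ℤ ℤ.* c ℤ.+ x ℤ.* eval (derivAux 2 cs) x
    ≡⟨ cong (λ t → 1ℤ ℤ.* c ℤ.+ x ℤ.* t) (derivAux-suc 1 cs x) ⟩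
  1ℤ ℤ.* c ℤ.+ x ℤ.* (eval (derivAux 1 cs) x ℤ.+ eval cs x)
    ≡⟨ regroup c x (eval (derivAux 1 cs) x) (eval cs x) ⟩
  (c ℤ.+ x ℤ.* eval cs x) ℤ.+ x ℤ.* eval (derivAux 1 cs) x ∎
  where
  open ≡-Reasoning
  regroup : ∀ c x D E → 1ℤ ℤ.* c ℤ.+ x ℤ.* (D ℤ.+ E) ≡ (c ℤ.+ x ℤ.* E) ℤ.+ x ℤ.* D
  regroup = solve-∀

taylor : ∀ Q x h → Σ ℤ λ R →
  eval Q (x ℤ.+ h) ≡ eval Q x ℤ.+ h ℤ.* eval (deriv Q) x ℤ.+ h ℤ.* h ℤ.* R
taylor []       x h = 0ℤ , zero-sum h
  where
  zero-sum : ∀ h → 0ℤ ≡ 0ℤ ℤ.+ h ℤ.* 0ℤ ℤ.+ h ℤ.* h ℤ.* 0ℤ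
  zero-sum = solve-∀
taylor (a ∷ as) x h = D ℤ.+ (x ℤ.+ h) ℤ.* R , (begin
  a ℤ.+ (x ℤ.+ h) ℤ.* eval as (x ℤ.+ h)
    ≡⟨ cong (λ t → a ℤ.+ (x ℤ.+ h) ℤ.* t) expansion ⟩
  a ℤ.+ (x ℤ.+ h) ℤ.* (E ℤ.+ h ℤ.* D ℤ.+ h ℤ.* h ℤ.* R)
    ≡⟨ regroup a x h E D R ⟩
  (a ℤ.+ x ℤ.* E) ℤ.+ h ℤ.* (E ℤ.+ x ℤ.* D) ℤ.+ h ℤ.* h ℤ.* (D ℤ.+ (x ℤ.+ h) ℤ.* R)
    ≡⟨ cong (λ t → (a ℤ.+ x ℤ.* E) ℤ.+ h ℤ.* t ℤ.+ h ℤ.* h ℤ.* (D ℤ.+ (x ℤ.+ h) ℤ.* R))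
            (sym (deriv-cons a as x)) ⟩
  eval (a ∷ as) x ℤ.+ h ℤ.* eval (deriv (a ∷ as)) x ℤ.+ h ℤ.* h ℤ.* (D ℤ.+ (x ℤ.+ h) ℤ.* R) ∎)
  where
  open ≡-Reasoning
  E = eval as x
  D = eval (deriv as) x
  R = proj₁ (taylor as x h)
  expansion = proj₂ (taylor as x h)
  regroup : ∀ a x h E D R →
    a ℤ.+ (x ℤ.+ h) ℤ.* (E ℤ.+ h ℤ.* D ℤ.+ h ℤ.* h ℤ.* R)
      ≡ (a ℤ.+ x ℤ.* E) ℤ.+ h ℤ.* (E ℤ.+ x ℤ.* D) ℤ.+ h ℤ.* h ℤ.* (D ℤ.+ (x ℤ.+ h) ℤ.* R)
  regroup = solve-∀

root-shift : ∀ Q {m} x h → m ∣ₛ h → m ∣ₛ eval Q x → m ∣ₛ eval Q (x ℤ.+ h)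
root-shift Q x h m∣h m∣Qx with taylor Q x h
... | R , expansion = subst (_ ∣ₛ_) (sym expansion)
  (S.∣m∣n⇒∣m+n (S.∣m∣n⇒∣m+n m∣Qx (S.∣m⇒∣m*n (eval (deriv Q) x) m∣h))
               (S.∣m⇒∣m*n R (S.∣m⇒∣m*n h m∣h)))

-- Consequently a root modulo a positive m is also attained at a positive
-- integer, namely at (b mod m) + m.
positive-root : ∀ Q m .{{_ : ℕ.NonZero m}} b → + m ∣ₛ eval Q b →
  Σ ℕ λ i → (1 ≤ i) × (+ m ∣ₛ eval Q (+ i))
positive-root Q m b m∣Qb =
  i , ℕP.≤-trans (ℕ.>-nonZero⁻¹ m) (ℕP.m≤n+m m (b ℤ.% + m)) ,
  subst (λ t → + m ∣ₛ eval Q t) (b+[i-b]≡i b (+ i)) (root-shift Q b (+ i ℤ.- b) m∣i-b m∣Qb)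
  where
  open ≡-Reasoning
  i = b ℤ.% + m ℕ.+ m
  b+[i-b]≡i : ∀ b i → b ℤ.+ (i ℤ.- b) ≡ i
  b+[i-b]≡i = solve-∀
  cancel : ∀ r m q → (r ℤ.+ m) ℤ.- (r ℤ.+ q ℤ.* m) ≡ (1ℤ ℤ.- q) ℤ.* m
  cancel = solve-∀
  m∣i-b : + m ∣ₛ (+ i ℤ.- b)
  m∣i-b = divides (1ℤ ℤ.- b ℤ./ + m) (begin
    + i ℤ.- b
      ≡⟨ cong₂ ℤ._-_ (ℤP.pos-+ (b ℤ.% + m) m) (a≡a%n+[a/n]*n b (+ m)) ⟩
    (+ (b ℤ.% + m) ℤ.+ + m) ℤ.- (+ (b ℤ.% + m) ℤ.+ b ℤ./ + m ℤ.* + m)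
      ≡⟨ cancel (+ (b ℤ.% + m)) (+ m) (b ℤ./ + m) ⟩
    (1ℤ ℤ.- b ℤ./ + m) ℤ.* + m ∎)

-- One lifting step, for arbitrary integers p ∣ N: if b is a root modulo N and
-- u inverts Q′(b) modulo p, then b - c·u·N (where Q(b) = c N) is a root
-- modulo p N, because Q(b - cuN) = cN(1 - u Q′(b)) + (cuN)² R.
hensel-step : ∀ {p N} Q b u → p ∣ₛ N → N ∣ₛ eval Q b →
  p ∣ₛ (u ℤ.* eval (deriv Q) b ℤ.- 1ℤ) → Σ ℤ λ b′ → p ℤ.* N ∣ₛ eval Q b′
hensel-step {p} {N} Q b u (divides K N≡Kp) (divides c Qb≡cN) (divides w ud-1≡wp) =
  b ℤ.+ h , divides (ℤ.- (c ℤ.* w) ℤ.+ (c ℤ.* u) ℤ.* (c ℤ.* u) ℤ.* K ℤ.* R) (begin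
    eval Q (b ℤ.+ h)
      ≡⟨ expansion ⟩
    eval Q b ℤ.+ h ℤ.* d ℤ.+ h ℤ.* h ℤ.* R
      ≡⟨ cong (λ t → t ℤ.+ h ℤ.* d ℤ.+ h ℤ.* h ℤ.* R) Qb≡cN ⟩
    c ℤ.* N ℤ.+ h ℤ.* d ℤ.+ h ℤ.* h ℤ.* R
      ≡⟨ factor c u N d R ⟩
    ℤ.- (c ℤ.* N) ℤ.* (u ℤ.* d ℤ.- 1ℤ) ℤ.+ (c ℤ.* u) ℤ.* (c ℤ.* u) ℤ.* N ℤ.* N ℤ.* R
      ≡⟨ cong₂ (λ s t → ℤ.- (c ℤ.* N) ℤ.* s ℤ.+ (c ℤ.* u) ℤ.* (c ℤ.* u) ℤ.* N ℤ.* t ℤ.* R)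
               ud-1≡wp N≡Kp ⟩
    ℤ.- (c ℤ.* N) ℤ.* (w ℤ.* p) ℤ.+ (c ℤ.* u) ℤ.* (c ℤ.* u) ℤ.* N ℤ.* (K ℤ.* p) ℤ.* R
      ≡⟨ collect c u w p N K R ⟩
    (ℤ.- (c ℤ.* w) ℤ.+ (c ℤ.* u) ℤ.* (c ℤ.* u) ℤ.* K ℤ.* R) ℤ.* (p ℤ.* N) ∎)
  where
  open ≡-Reasoning
  d = eval (deriv Q) b
  h = ℤ.- (c ℤ.* u) ℤ.* N
  R = proj₁ (taylor Q b h)
  expansion = proj₂ (taylor Q b h)
  factor : ∀ c u N d R →
    c ℤ.* N ℤ.+ (ℤ.- (c ℤ.* u) ℤ.* N) ℤ.* d ℤ.+ (ℤ.- (c ℤ.* u) ℤ.* N) ℤ.* (ℤ.- (c ℤ.* u) ℤ.* N) ℤ.* R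
      ≡ ℤ.- (c ℤ.* N) ℤ.* (u ℤ.* d ℤ.- 1ℤ) ℤ.+ (c ℤ.* u) ℤ.* (c ℤ.* u) ℤ.* N ℤ.* N ℤ.* R
  factor = solve-∀
  collect : ∀ c u w p N K R →
    ℤ.- (c ℤ.* N) ℤ.* (w ℤ.* p) ℤ.+ (c ℤ.* u) ℤ.* (c ℤ.* u) ℤ.* N ℤ.* (K ℤ.* p) ℤ.* R
      ≡ (ℤ.- (c ℤ.* w) ℤ.+ (c ℤ.* u) ℤ.* (c ℤ.* u) ℤ.* K ℤ.* R) ℤ.* (p ℤ.* N)
  collect = solve-∀

prime∤⇒coprime : ∀ {p n} → Prime p → ¬ (p ℕD.∣ n) → Coprime p n
prime∤⇒coprime pp p∤n {d} (d∣p , d∣n) with prime⇒irreducible pp d∣p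
... | inj₁ d≡1 = d≡1
... | inj₂ refl = ⊥-elim (p∤n d∣n)

cast-ℤ : ∀ a b c d e → a ℕ.+ b ℕ.* c ≡ d ℕ.* e → + a ℤ.+ + b ℤ.* + c ≡ + d ℤ.* + e
cast-ℤ a b c d e eq = begin
  + a ℤ.+ + b ℤ.* + c   ≡⟨ cong (λ t → + a ℤ.+ t) (sym (ℤP.pos-* b c)) ⟩
  + a ℤ.+ + (b ℕ.* c)   ≡⟨ sym (ℤP.pos-+ a (b ℕ.* c)) ⟩
  + (a ℕ.+ b ℕ.* c)     ≡⟨ cong +_ eq ⟩
  + (d ℕ.* e)           ≡⟨ ℤP.pos-* d e ⟩
  + d ℤ.* + e           ∎
  where open ≡-Reasoning

inverse-mod-prime : ∀ {p} → Prime p → ∀ d → ¬ (+ p ∣ d) → Σ ℤ λ u → + p ∣ₛ (u ℤ.* d ℤ.- 1ℤ)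
inverse-mod-prime {p} pp (+ n) p∤n with coprime-Bézout (prime∤⇒coprime pp p∤n)
... | Bézout.+- x y 1+yn≡xp = ℤ.- + y , divides (ℤ.- + x) (begin
  ℤ.- + y ℤ.* + n ℤ.- 1ℤ         ≡⟨ negate (+ y) (+ n) ⟩
  ℤ.- (1ℤ ℤ.+ + y ℤ.* + n)        ≡⟨ cong ℤ.-_ (cast-ℤ 1 y n x p 1+yn≡xp) ⟩
  ℤ.- (+ x ℤ.* + p)               ≡⟨ ℤP.neg-distribˡ-* (+ x) (+ p) ⟩
  ℤ.- + x ℤ.* + p                 ∎)
  where
  open ≡-Reasoning
  negate : ∀ y n → ℤ.- y ℤ.* n ℤ.- 1ℤ ≡ ℤ.- (1ℤ ℤ.+ y ℤ.* n)
  negate = solve-∀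
... | Bézout.-+ x y 1+xp≡yn = + y , divides (+ x) (begin
  + y ℤ.* + n ℤ.- 1ℤ              ≡⟨ cong (ℤ._- 1ℤ) (sym (cast-ℤ 1 x p y n 1+xp≡yn)) ⟩
  (1ℤ ℤ.+ + x ℤ.* + p) ℤ.- 1ℤ     ≡⟨ cancel (+ x ℤ.* + p) ⟩
  + x ℤ.* + p                     ∎)
  where
  open ≡-Reasoning
  cancel : ∀ t → (1ℤ ℤ.+ t) ℤ.- 1ℤ ≡ t
  cancel = solve-∀
inverse-mod-prime pp -[1+ m ] p∤d with inverse-mod-prime pp (+ suc m) p∤d
... | u , p∣un-1 = ℤ.- u , subst (λ t → _ ∣ₛ (t ℤ.- 1ℤ)) (sym (neg-*-neg u (+ suc m))) p∣un-1
  where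
  neg-*-neg : ∀ u n → ℤ.- u ℤ.* ℤ.- n ≡ u ℤ.* n
  neg-*-neg = solve-∀

hensel-lift : ∀ {p} → Prime p → ∀ Q → Σ ℤ (λ b → + p ∣ eval Q b) →
  (∀ b → + p ∣ eval Q b → ¬ (+ p ∣ eval (deriv Q) b)) →
  ∀ k → Σ ℤ λ b → + (p ^ suc k) ∣ₛ eval Q b
hensel-lift {p} pp Q (b , p∣Qb) simple zero =
  b , subst (λ m → + m ∣ₛ eval Q b) (sym (ℕP.*-identityʳ p)) (∣ᵤ⇒∣ p∣Qb)
hensel-lift {p} pp Q root simple (suc k) =
  b′ , subst (_∣ₛ eval Q b′) (sym (ℤP.pos-* p (p ^ suc k))) lifted
  where
  p∣pᵏ⁺¹ : + p ∣ₛ + (p ^ suc k)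
  p∣pᵏ⁺¹ = divides (+ (p ^ k)) (trans (ℤP.pos-* p (p ^ k)) (ℤP.*-comm (+ p) (+ (p ^ k))))
  b = proj₁ (hensel-lift pp Q root simple k)
  pᵏ⁺¹∣Qb : + (p ^ suc k) ∣ₛ eval Q b
  pᵏ⁺¹∣Qb = proj₂ (hensel-lift pp Q root simple k)
  inverse = inverse-mod-prime pp (eval (deriv Q) b) (simple b (∣⇒∣ᵤ (S.∣-trans p∣pᵏ⁺¹ pᵏ⁺¹∣Qb)))
  lift = hensel-step Q b (proj₁ inverse) p∣pᵏ⁺¹ pᵏ⁺¹∣Qb (proj₂ inverse)
  b′ = proj₁ lift
  lifted : + p ℤ.* + (p ^ suc k) ∣ₛ eval Q b′
  lifted = proj₂ lift

norm₁ : Poly → ℕ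
norm₁ []       = 0
norm₁ (a ∷ as) = ℤ.∣ a ∣ ℕ.+ norm₁ as

eval-zeroPoly : ∀ as → isZeroPoly as ≡ true → ∀ x → eval as x ≡ 0ℤ
eval-zeroPoly []       _  x = refl
eval-zeroPoly (a ∷ as) eq x with a ℤ.≟ 0ℤ
eval-zeroPoly (a ∷ as) eq x | yes refl =
  trans (cong (λ t → 0ℤ ℤ.+ x ℤ.* t) (eval-zeroPoly as eq x))
        (trans (ℤP.+-identityˡ (x ℤ.* 0ℤ)) (ℤP.*-zeroʳ x))
eval-zeroPoly (a ∷ as) () x | no _

eval-bound : ∀ Q i → 1 ≤ i → ℤ.∣ eval Q (+ i) ∣ ≤ norm₁ Q ℕ.* i ^ deg Q
eval-bound []       i 1≤i = z≤n
eval-bound (c ∷ as) i 1≤i with isZeroPoly as in zero-tail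
... | true = begin
  ℤ.∣ c ℤ.+ + i ℤ.* eval as (+ i) ∣
    ≡⟨ cong (λ t → ℤ.∣ c ℤ.+ + i ℤ.* t ∣) (eval-zeroPoly as zero-tail (+ i)) ⟩
  ℤ.∣ c ℤ.+ + i ℤ.* 0ℤ ∣
    ≡⟨ cong (λ t → ℤ.∣ c ℤ.+ t ∣) (ℤP.*-zeroʳ (+ i)) ⟩
  ℤ.∣ c ℤ.+ 0ℤ ∣
    ≡⟨ cong ℤ.∣_∣ (ℤP.+-identityʳ c) ⟩
  ℤ.∣ c ∣
    ≤⟨ ℕP.m≤m+n ℤ.∣ c ∣ (norm₁ as) ⟩
  ℤ.∣ c ∣ ℕ.+ norm₁ as
    ≡⟨ ℕP.*-identityʳ (ℤ.∣ c ∣ ℕ.+ norm₁ as) ⟨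
  (ℤ.∣ c ∣ ℕ.+ norm₁ as) ℕ.* 1 ∎
  where open ℕP.≤-Reasoning
... | false = begin
  ℤ.∣ c ℤ.+ + i ℤ.* eval as (+ i) ∣
    ≤⟨ ℤP.∣i+j∣≤∣i∣+∣j∣ c (+ i ℤ.* eval as (+ i)) ⟩
  ℤ.∣ c ∣ ℕ.+ ℤ.∣ + i ℤ.* eval as (+ i) ∣
    ≡⟨ cong (ℤ.∣ c ∣ ℕ.+_) (ℤP.abs-* (+ i) (eval as (+ i))) ⟩
  ℤ.∣ c ∣ ℕ.+ i ℕ.* ℤ.∣ eval as (+ i) ∣
    ≤⟨ ℕP.+-mono-≤ (ℕP.m≤m*n ℤ.∣ c ∣ (i ^ suc (deg as)) {{iᵈ≢0}}) (ℕP.*-monoʳ-≤ i (eval-bound as i 1≤i)) ⟩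
  ℤ.∣ c ∣ ℕ.* i ^ suc (deg as) ℕ.+ i ℕ.* (norm₁ as ℕ.* i ^ deg as)
    ≡⟨ cong (ℤ.∣ c ∣ ℕ.* i ^ suc (deg as) ℕ.+_) (*-left-comm i (norm₁ as) (i ^ deg as)) ⟩
  ℤ.∣ c ∣ ℕ.* i ^ suc (deg as) ℕ.+ norm₁ as ℕ.* i ^ suc (deg as)
    ≡⟨ ℕP.*-distribʳ-+ (i ^ suc (deg as)) ℤ.∣ c ∣ (norm₁ as) ⟨
  (ℤ.∣ c ∣ ℕ.+ norm₁ as) ℕ.* i ^ suc (deg as) ∎
  where
  open ℕP.≤-Reasoning
  iᵈ≢0 : ℕ.NonZero (i ^ suc (deg as))
  iᵈ≢0 = ℕP.m^n≢0 i (suc (deg as)) {{ℕ.>-nonZero 1≤i}}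

divisor-bound : ∀ {m z} → z ≢ 0ℤ → + m ∣ z → m ≤ ℤ.∣ z ∣
divisor-bound z≢0 m∣z =
  ℕD.∣⇒≤ {{ℕ.≢-nonZero (λ ∣z∣≡0 → z≢0 (ℤP.∣i∣≡0⇒i≡0 ∣z∣≡0))}} m∣z

exponent<power : ∀ {m} → 2 ≤ m → ∀ j → j < m ^ j
exponent<power 2≤m zero    = s≤s z≤n
exponent<power {m} 2≤m (suc j) = begin
  1 ℕ.+ suc j           ≤⟨ ℕP.+-mono-≤ (ℕP.≤-trans (s≤s z≤n) j<mʲ) j<mʲ ⟩
  m ^ j ℕ.+ m ^ j       ≡⟨ cong (m ^ j ℕ.+_) (ℕP.+-identityʳ (m ^ j)) ⟨
  2 ℕ.* m ^ j           ≤⟨ ℕP.*-monoˡ-≤ (m ^ j) 2≤m ⟩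
  m ℕ.* m ^ j           ∎
  where
  open ℕP.≤-Reasoning
  j<mʲ = exponent<power 2≤m j

Attained : ℕ → Poly → ℕ → ℕ → Set
Attained p Q n j = Σ ℕ λ i → (1 ≤ i) × (i ≤ n) × (+ (p ^ j) ∣ eval Q (+ i))

in-range? : ∀ {D : ℕ → Set} → (∀ i → Dec (D i)) → ∀ n →
  Dec (Σ ℕ λ i → (1 ≤ i) × (i ≤ n) × D i)
in-range? D? n = map′
  (λ { (i , s≤s i≤n , 1≤i , Di) → i , 1≤i , i≤n , Di })
  (λ { (i , 1≤i , i≤n , Di) → i , s≤s i≤n , 1≤i , Di })
  (ℕP.anyUpTo? (λ i → (1 ℕ.≤? i) ×-dec D? i) (suc n))

attained? : ∀ p Q n j → Dec (Attained p Q n j)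
attained? p Q n j = in-range? (λ i → (p ^ j) ℕD.∣? ℤ.∣ eval Q (+ i) ∣) n

largest : ∀ {P : ℕ → Set} → (∀ j → Dec (P j)) → P 0 → ∀ B → (∀ j → P j → j ≤ B) →
  Σ ℕ λ r → P r × (∀ j → P j → j ≤ r)
largest P? P0 zero    bounded = 0 , P0 , bounded
largest P? P0 (suc B) bounded with P? (suc B)
... | yes PB = suc B , PB , bounded
... | no ¬PB = largest P? P0 B λ j Pj →
  ℕP.≤-pred (ℕP.≤∧≢⇒< (bounded j Pj) (λ { refl → ¬PB Pj }))

attained-bound : ∀ {p} Q → (∀ k → eval Q (+ k) ≢ 0ℤ) →
  ∀ {n j} → Attained p Q n j → p ^ j ≤ norm₁ Q ℕ.* n ^ deg Q
attained-bound {p} Q nonvanishing {n} {j} (i , 1≤i , i≤n , pʲ∣Qi) = begin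
  p ^ j                   ≤⟨ divisor-bound (nonvanishing i) pʲ∣Qi ⟩
  ℤ.∣ eval Q (+ i) ∣      ≤⟨ eval-bound Q i 1≤i ⟩
  norm₁ Q ℕ.* i ^ deg Q   ≤⟨ ℕP.*-monoʳ-≤ (norm₁ Q) (ℕP.^-monoˡ-≤ (deg Q) i≤n) ⟩
  norm₁ Q ℕ.* n ^ deg Q   ∎
  where open ℕP.≤-Reasoning

-- r_n exists: the attained exponents include 0 and are bounded since j < p^j.
rₙ-exists : ∀ {p} → Prime p → ∀ Q → (∀ k → eval Q (+ k) ≢ 0ℤ) →
  ∀ n → 1 ≤ n → Σ ℕ (IsRn p Q n)
rₙ-exists {p} pp Q nonvanishing n 1≤n =
  r , attained , λ i j 1≤i i≤n pʲ∣Qi → maximal j (i , 1≤i , i≤n , pʲ∣Qi)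
  where
  bounded : ∀ j → Attained p Q n j → j ≤ norm₁ Q ℕ.* n ^ deg Q
  bounded j att = ℕP.<⇒≤ (ℕP.<-≤-trans
    (exponent<power (ℕ.nonTrivial⇒n>1 p {{prime⇒nonTrivial pp}}) j)
    (attained-bound {p} Q nonvanishing {n} {j} att))
  maximum = largest (attained? p Q n) (1 , ℕP.≤-refl , 1≤n , ℕD.1∣ _) (norm₁ Q ℕ.* n ^ deg Q) bounded
  r = proj₁ maximum
  attained = proj₁ (proj₂ maximum)
  maximal = proj₂ (proj₂ maximum)

-- r_n → ∞: a root modulo p^(M+1) at a positive i gives r_n ≥ M + 1 for n ≥ i.
rₙ-unbounded : ∀ {p} → Prime p → ∀ Q → Σ ℤ (λ b → + p ∣ eval Q b) →
  (∀ b → + p ∣ eval Q b → ¬ (+ p ∣ eval (deriv Q) b)) →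
  ∀ M → Σ ℕ λ N → ∀ n r → N ≤ n → IsRn p Q n r → M ≤ r
rₙ-unbounded {p} pp Q root simple M =
  i , λ n r i≤n (_ , maximal) → ℕP.<⇒≤ (maximal i (suc M) 1≤i i≤n (∣⇒∣ᵤ pᴹ⁺¹∣Qi))
  where
  lifted = hensel-lift pp Q root simple M
  positive = positive-root Q (p ^ suc M) {{ℕP.m^n≢0 p (suc M) {{prime⇒nonZero pp}}}}
               (proj₁ lifted) (proj₂ lifted)
  i = proj₁ positive
  1≤i = proj₁ (proj₂ positive)
  pᴹ⁺¹∣Qi = proj₂ (proj₂ positive)

rₙ-power-bound : ∀ {p} Q → (∀ k → eval Q (+ k) ≢ 0ℤ) →
  ∀ n r → norm₁ Q ≤ n → IsRn p Q n r → p ^ r ≤ n ^ (deg Q + 1)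
rₙ-power-bound {p} Q nonvanishing n r ‖Q‖≤n (attained , _) = begin
  p ^ r                   ≤⟨ attained-bound {p} Q nonvanishing {n} {r} attained ⟩
  norm₁ Q ℕ.* n ^ deg Q   ≤⟨ ℕP.*-monoˡ-≤ (n ^ deg Q) ‖Q‖≤n ⟩
  n ^ suc (deg Q)         ≡⟨ cong (n ^_) (ℕP.+-comm 1 (deg Q)) ⟩
  n ^ (deg Q + 1)         ∎
  where open ℕP.≤-Reasoning

lemma2p2 : (p : ℕ) → Prime p → (Q : Poly)
    → (∀ (k : ℕ) → eval Q (+ k) ≢ 0ℤ)
    → Σ ℤ (λ b → (+ p) ∣ eval Q b)
    → (∀ (b : ℤ) → (+ p) ∣ eval Q b → ¬ ((+ p) ∣ eval (deriv Q) b))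
    → ((n : ℕ) → 1 ≤ n → Σ ℕ (λ r → IsRn p Q n r))
    × ((M : ℕ) → Σ ℕ (λ N → (n r : ℕ) → N ≤ n → IsRn p Q n r → M ≤ r))
    × Σ ℕ (λ N → (n r : ℕ) → N ≤ n → IsRn p Q n r → p ^ r ≤ n ^ (deg Q + 1))
lemma2p2 p pp Q nonvanishing root simple =
  rₙ-exists pp Q nonvanishing ,
  rₙ-unbounded pp Q root simple ,
  (norm₁ Q , rₙ-power-bound Q nonvanishing)
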